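{- Let $p$ be a prime and $z \in \mathbb{Z}$. Then $z \in \{p^n \mid n \in \mathbb{N}\}$ if and only if $X_2^z - X_1^z = 1$ in the $\mathbb{F}_p[X_1^{\pm1}, X_2^{\pm1}]$-module $\mathbb{F}_p[X_1^{\pm1}, X_2^{\pm1}]/\langle X_2 - X_1 - 1\rangle$.
   Context: $\mathbb{N}$ contains $0$. -}

module Defs where

open import Data.Nat using (ℕ)
open import Data.Integer using (ℤ; +_; -_; _+_; _-_; _*_)
open import Data.Integer.Divisibility using (_∣_)
open import Data.Integer.Properties using (_≟_)
open import Data.List using (List; []; _∷_; [_]; _++_; map; concatMap; foldr)
open import Data.Product using (_×_; _,_; ∃-syntax)
open import Relation.Nullary using (yes; no)

-- Laurent polynomials in two variables X₁, X₂ with integer coefficients,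
-- represented as finite lists of terms  c · X₁^a · X₂^b  (c , a , b),
-- repeated exponents allowed (coefficients add up).
Term : Set
Term = ℤ × ℤ × ℤ

LPoly : Set
LPoly = List Term

coeff : LPoly → ℤ → ℤ → ℤ
coeff [] a b = + 0
coeff ((c , e₁ , e₂) ∷ f) a b with e₁ ≟ a | e₂ ≟ b
... | yes _ | yes _ = c + coeff f a b
... | _     | _     = coeff f a b

_⊕_ : LPoly → LPoly → LPoly
f ⊕ g = f ++ g

⊖_ : LPoly → LPoly
⊖ f = map (λ { (c , e) → (- c , e) }) f

_⊝_ : LPoly → LPoly → LPoly
f ⊝ g = f ⊕ (⊖ g)

_⊗_ : LPoly → LPoly → LPoly
f ⊗ g = concatMap (λ { (c , a , b) →
          map (λ { (d , a' , b') → (c * d , a + a' , b + b') }) g }) f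

one : LPoly
one = [ (+ 1 , + 0 , + 0) ]

X₁^ : ℤ → LPoly
X₁^ z = [ (+ 1 , z , + 0) ]

X₂^ : ℤ → LPoly
X₂^ z = [ (+ 1 , + 0 , z) ]

-- Equality in 𝔽_p[X₁^{±1}, X₂^{±1}] ( = ℤ[X₁^{±1}, X₂^{±1}] / p ):
-- all coefficients agree modulo p.
_≈[_]_ : LPoly → ℕ → LPoly → Set
f ≈[ p ] g = ∀ a b → (+ p) ∣ (coeff f a b - coeff g a b)

QuotEq : ℕ → LPoly → LPoly → LPoly → Set
QuotEq p h f g = ∃[ q ] ((f ⊝ g) ≈[ p ] (q ⊗ h))

gen : LPoly
gen = (X₂^ (+ 1) ⊝ X₁^ (+ 1)) ⊝ one

module Submission where

open import Defs
open import Data.Nat using (ℕ; _^_)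
open import Data.Nat.Primality using (Prime)
open import Data.Integer using (ℤ; +_)
open import Data.Product using (∃-syntax)
open import Relation.Binary.PropositionalEquality using (_≡_)
open import Function.Bundles using (_⇔_)

open import Algebra.Properties.CommutativeSemigroup using (x∙yz≈y∙xz)
open import Data.List using ([]; _∷_; map; length)
open import Data.Nat using (zero; suc)
open import Data.Nat.Combinatorics using (_C_; nCk+nC[k+1]≡[n+1]C[k+1]; nCn≡1; nC1≡n; k>n⇒nCk≡0)
open import Data.Nat.Primality using (euclidsLemma; prime⇒nonZero; prime⇒nonTrivial)
open import Data.Product using (_×_; _,_; ∃₂)
open import Data.Sum using (_⊎_; inj₁; inj₂)
open import Function.Bundles using (mk⇔)
open import Relation.Binary.Definitions using (tri<; tri≈; tri>)
open import Relation.Binary.PropositionalEquality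
  using (_≢_; refl; sym; trans; cong; cong₂; subst; subst₂; module ≡-Reasoning)
open import Relation.Nullary using (yes; no; contradiction)
import Data.Nat as ℕ
import Data.Nat.Divisibility as ℕ
import Data.Nat.Properties as ℕ

-- Substituting X₁ ↦ X and X₂ ↦ 1 + X kills X₂ − X₁ − 1, so reading off the coefficient of Xʳ
-- (expanding (1 + X)ᵇ as a power series also for b < 0) gives integer-valued linear
-- functionals vanishing on the ideal ⟨X₂ − X₁ − 1⟩. If X₂ᶻ − X₁ᶻ ≡ 1 modulo the ideal and p,
-- then p divides every coefficient of (1 + X)ᶻ − Xᶻ − 1. At r = z this coefficient is −1 when
-- z ≤ 0. For z > 0 not a power of p write z = pᵏm with p ∤ m and m ≥ 2: then
-- C(z, pᵏ) = m · C(z − 1, pᵏ − 1), and p divides neither factor, since p divides every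
-- C(z, j) with 0 < j < pᵏ. Conversely, X₂ⁿ − (X₁ + 1)ⁿ = (X₂ − X₁ − 1) · Σ_{i<n} X₂ⁱ (X₁ + 1)ⁿ⁻¹⁻ⁱ
-- exactly, and for n = pᵏ the remaining difference (X₁ + 1)ⁿ − X₁ⁿ − 1 has the coefficients
-- C(n, j) with 0 < j < n, all divisible by p.

module _ where
  open import Data.Nat
  open import Data.Nat.Properties
  open import Data.Nat.Divisibility
  open import Data.Nat.Induction using (<-wellFounded)
  open import Data.Nat.Tactic.RingSolver using (solve-∀)
  open import Induction.WellFounded using (Acc; acc)

  [k+1]*[n+1]C[k+1]≡[n+1]*nCk : ∀ n k → suc k * (suc n C suc k) ≡ suc n * (n C k)
  [k+1]*[n+1]C[k+1]≡[n+1]*nCk n zero = begin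
    1 * (suc n C 1)  ≡⟨ *-identityˡ _ ⟩
    suc n C 1        ≡⟨ nC1≡n (suc n) ⟩
    suc n            ≡⟨ *-identityʳ (suc n) ⟨
    suc n * 1        ∎
    where open ≡-Reasoning
  [k+1]*[n+1]C[k+1]≡[n+1]*nCk zero (suc k) = *-zeroʳ (2 + k)
  [k+1]*[n+1]C[k+1]≡[n+1]*nCk (suc n) (suc k) = begin
    (2 + k) * ((2 + n) C (2 + k))
      ≡⟨ cong ((2 + k) *_) (nCk+nC[k+1]≡[n+1]C[k+1] (suc n) (suc k)) ⟨
    (2 + k) * ((1 + n) C (1 + k) + (1 + n) C (2 + k))
      ≡⟨ regroup k ((1 + n) C (1 + k)) ((1 + n) C (2 + k)) ⟩
    (1 + k) * ((1 + n) C (1 + k)) + (1 + n) C (1 + k) + (2 + k) * ((1 + n) C (2 + k))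
      ≡⟨ cong₂ (λ x y → x + (1 + n) C (1 + k) + y)
               ([k+1]*[n+1]C[k+1]≡[n+1]*nCk n k) ([k+1]*[n+1]C[k+1]≡[n+1]*nCk n (suc k)) ⟩
    (1 + n) * (n C k) + (1 + n) C (1 + k) + (1 + n) * (n C (1 + k))
      ≡⟨ cong (λ x → (1 + n) * (n C k) + x + (1 + n) * (n C (1 + k))) (nCk+nC[k+1]≡[n+1]C[k+1] n k) ⟨
    (1 + n) * (n C k) + (n C k + n C (1 + k)) + (1 + n) * (n C (1 + k))
      ≡⟨ collect n (n C k) (n C (1 + k)) ⟩
    (2 + n) * (n C k + n C (1 + k))
      ≡⟨ cong ((2 + n) *_) (nCk+nC[k+1]≡[n+1]C[k+1] n k) ⟩
    (2 + n) * ((1 + n) C (1 + k))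
      ∎
    where
    open ≡-Reasoning
    regroup : ∀ k x y → (2 + k) * (x + y) ≡ (1 + k) * x + x + (2 + k) * y
    regroup = solve-∀
    collect : ∀ n x y → (1 + n) * x + (x + y) + (1 + n) * y ≡ (2 + n) * (x + y)
    collect = solve-∀

  module _ {p : ℕ} (p-prime : Prime p) where

    private instance
      p≢0 : NonZero p
      p≢0 = prime⇒nonZero p-prime
      p>1 : NonTrivial p
      p>1 = prime⇒nonTrivial p-prime

    p∤1 : p ∤ 1
    p∤1 p∣1 = <⇒≢ (nonTrivial⇒n>1 p) (sym (∣1⇒≡1 p∣1))

    p^k∣m*n∧p∤n⇒p^k∣m : ∀ k {m n} → p ^ k ∣ m * n → p ∤ n → p ^ k ∣ m
    p^k∣m*n∧p∤n⇒p^k∣m zero {m} _ _ = 1∣ m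
    p^k∣m*n∧p∤n⇒p^k∣m (suc k) {m} {n} p^[1+k]∣m*n p∤n
      with euclidsLemma m n p-prime (∣-trans (m∣m*n (p ^ k)) p^[1+k]∣m*n)
    ... | inj₂ p∣n = contradiction p∣n p∤n
    ... | inj₁ (divides q refl) = subst (p * p ^ k ∣_) (*-comm p q) (*-monoʳ-∣ p p^k∣q)
      where
      swap : ∀ q p n → q * p * n ≡ p * (q * n)
      swap = solve-∀
      p^k∣q : p ^ k ∣ q
      p^k∣q = p^k∣m*n∧p∤n⇒p^k∣m k (*-cancelˡ-∣ p (subst (p * p ^ k ∣_) (swap q p n) p^[1+k]∣m*n)) p∤n

    p^k∣n⇒p∣nCj : ∀ k {n j} → p ^ k ∣ n → 0 < j → j < p ^ k → p ∣ n C j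
    p^k∣n⇒p∣nCj k {zero}  {suc j} _ _ _ = p ∣0
    p^k∣n⇒p∣nCj k {suc n} {suc j} p^k∣1+n _ 1+j<p^k with p ∣? suc n C suc j
    ... | yes p∣C = p∣C
    ... | no  p∤C = contradiction (∣⇒≤ p^k∣1+j) (<⇒≱ 1+j<p^k)
      where
      p^k∣1+j : p ^ k ∣ suc j
      p^k∣1+j = p^k∣m*n∧p∤n⇒p^k∣m k
        (subst (p ^ k ∣_) (sym ([k+1]*[n+1]C[k+1]≡[n+1]*nCk n j)) (∣m⇒∣m*n (n C j) p^k∣1+n)) p∤C

    p^k∣1+n⇒p∤nCj : ∀ k {n j} → p ^ k ∣ suc n → j < p ^ k → p ∤ n C j
    p^k∣1+n⇒p∤nCj k {n} {zero}  _ _ = p∤1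
    p^k∣1+n⇒p∤nCj k {n} {suc j} p^k∣1+n 1+j<p^k p∣nC[1+j] =
      p^k∣1+n⇒p∤nCj k p^k∣1+n (<-trans (n<1+n j) 1+j<p^k) (∣m+n∣m⇒∣n p∣nC[1+j]+nCj p∣nC[1+j])
      where
      p∣nC[1+j]+nCj : p ∣ n C (suc j) + n C j
      p∣nC[1+j]+nCj = subst (p ∣_) (trans (sym (nCk+nC[k+1]≡[n+1]C[k+1] n j)) (+-comm (n C j) _))
        (p^k∣n⇒p∣nCj k p^k∣1+n z<s 1+j<p^k)

    p∤[p^k*m]C[p^k] : ∀ k {m} .{{_ : NonZero m}} → p ∤ m → p ∤ (p ^ k * m) C (p ^ k)
    p∤[p^k*m]C[p^k] k {m} p∤m = subst₂ (λ n j → p ∤ n C j) (suc-pred (p ^ k * m)) (suc-pred (p ^ k))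
      (p∤[1+n]C[1+j] (suc-pred (p ^ k)) (suc-pred (p ^ k * m)))
      where
      instance
        p^k≢0 : NonZero (p ^ k)
        p^k≢0 = m^n≢0 p k
        p^k*m≢0 : NonZero (p ^ k * m)
        p^k*m≢0 = m*n≢0 (p ^ k) m
      p∤[1+n]C[1+j] : ∀ {j n} → suc j ≡ p ^ k → suc n ≡ p ^ k * m → p ∤ suc n C suc j
      p∤[1+n]C[1+j] {j} {n} 1+j≡p^k 1+n≡p^k*m p∣C
        with euclidsLemma m (n C j) p-prime (subst (p ∣_) C≡m*nCj p∣C)
        where
        open ≡-Reasoning
        C≡m*nCj : suc n C suc j ≡ m * (n C j)
        C≡m*nCj = *-cancelˡ-≡ _ _ (suc j) (begin
          suc j * (suc n C suc j) ≡⟨ [k+1]*[n+1]C[k+1]≡[n+1]*nCk n j ⟩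
          suc n * (n C j)         ≡⟨ cong (_* (n C j)) (trans 1+n≡p^k*m (cong (_* m) (sym 1+j≡p^k))) ⟩
          suc j * m * (n C j)     ≡⟨ *-assoc (suc j) m (n C j) ⟩
          suc j * (m * (n C j))   ∎)
      ... | inj₁ p∣m   = p∤m p∣m
      ... | inj₂ p∣nCj = p^k∣1+n⇒p∤nCj k (divides m (trans 1+n≡p^k*m (*-comm (p ^ k) m)))
                                          (subst (j <_) 1+j≡p^k ≤-refl) p∣nCj

    p-power-factorisation : ∀ n → .{{NonZero n}} → ∃₂ λ k m → n ≡ p ^ k * m × p ∤ m
    p-power-factorisation n = go n (<-wellFounded n)
      where
      go : ∀ n → Acc _<_ n → .{{NonZero n}} → ∃₂ λ k m → n ≡ p ^ k * m × p ∤ m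
      go n (acc rec) with p ∣? n
      ... | no p∤n = 0 , n , sym (+-identityʳ n) , p∤n
      ... | yes p∣n@(divides q n≡q*p)
        with k , m , q≡p^k*m , p∤m ← go q (rec (quotient-< p∣n)) {{quotient≢0 p∣n}}
        = suc k , m , trans n≡q*p (trans (cong (_* p) q≡p^k*m) (rotate (p ^ k) m p)) , p∤m
        where
        rotate : ∀ x m p → x * m * p ≡ p * x * m
        rotate = solve-∀

    p-power⊎p∤binomial : ∀ n → .{{NonZero n}} → (∃[ k ] n ≡ p ^ k) ⊎ (∃[ j ] 0 < j × j < n × p ∤ n C j)
    p-power⊎p∤binomial n with p-power-factorisation n
    ... | k , 0 , n≡p^k*0 , _ = contradiction (trans n≡p^k*0 (*-zeroʳ (p ^ k))) (≢-nonZero⁻¹ n)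
    ... | k , 1 , n≡p^k*1 , _ = inj₁ (k , trans n≡p^k*1 (*-identityʳ (p ^ k)))
    ... | k , m@(2+ _) , n≡p^k*m , p∤m =
      inj₂ (p ^ k , m^n>0 p k , p^k<n , subst (λ n → p ∤ n C p ^ k) (sym n≡p^k*m) (p∤[p^k*m]C[p^k] k p∤m))
      where
      p^k<n : p ^ k < n
      p^k<n = subst (p ^ k <_) (sym n≡p^k*m) (m<m*n (p ^ k) m {{m^n≢0 p k}} (s<s z<s))

open import Data.Integer using (-[1+_]; -_; _+_; _-_; _*_; 0ℤ; 1ℤ; -1ℤ) renaming (_^_ to _^ℤ_)
open import Data.Integer.Divisibility.Signed
  using (_∣_; divides; ∣ᵤ⇒∣; ∣⇒∣ᵤ; ∣m∣n⇒∣m+n; ∣m⇒∣m*n; ∣m+n∣m⇒∣n)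
open import Data.Integer.Properties
open import Data.Integer.Tactic.RingSolver using (solve-∀)

δ : ℤ → ℤ → ℤ
δ x y with x ≟ y
... | yes _ = 1ℤ
... | no  _ = 0ℤ

δ-refl : ∀ x → δ x x ≡ 1ℤ
δ-refl x with x ≟ x
... | yes _   = refl
... | no  x≢x = contradiction refl x≢x

δ-≢ : ∀ {x y} → x ≢ y → δ x y ≡ 0ℤ
δ-≢ {x} {y} x≢y with x ≟ y
... | yes x≡y = contradiction x≡y x≢y
... | no  _   = refl

δ-shift : ∀ x s y → δ (x + s) y ≡ δ x (y - s)
δ-shift x s y with x ≟ y - s
... | yes refl = trans (cong (λ t → δ t y) (minus-plus y s)) (δ-refl y)
  where
  minus-plus : ∀ y s → y - s + s ≡ y
  minus-plus = solve-∀
... | no  x≢y-s = δ-≢ (λ x+s≡y → x≢y-s (trans (sym (plus-minus x s)) (cong (_- s) x+s≡y)))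
  where
  plus-minus : ∀ x s → x + s - s ≡ x
  plus-minus = solve-∀

-- The coefficient of Xᵏ in the power series (1 + X)ᵇ, for every b ∈ ℤ.
binomial : ℤ → ℤ → ℤ
binomial b        -[1+ _ ] = 0ℤ
binomial (+ n)    (+ k)    = + (n C k)
binomial -[1+ m ] (+ k)    = -1ℤ ^ℤ k * + ((m ℕ.+ k) C k)

binomial[b,0]≡1 : ∀ b → binomial b 0ℤ ≡ 1ℤ
binomial[b,0]≡1 (+ n)    = refl
binomial[b,0]≡1 -[1+ m ] = refl

binomial[0,k]≡δ : ∀ k → binomial 0ℤ k ≡ δ 0ℤ k
binomial[0,k]≡δ -[1+ k ]  = sym (δ-≢ {0ℤ} { -[1+ k ]} λ ())
binomial[0,k]≡δ (+ zero)  = sym (δ-refl 0ℤ)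
binomial[0,k]≡δ (+ suc k) = sym (δ-≢ {0ℤ} {+ suc k} λ ())

binomial-pascal : ∀ b k → binomial (b + 1ℤ) k ≡ binomial b k + binomial b (k - 1ℤ)
binomial-pascal b        -[1+ k ]    = refl
binomial-pascal b        (+ zero)    =
  trans (binomial[b,0]≡1 (b + 1ℤ)) (sym (trans (+-identityʳ _) (binomial[b,0]≡1 b)))
binomial-pascal (+ n)    (+ suc k) = begin
  + ((n ℕ.+ 1) C suc k)               ≡⟨ cong (λ m → + (m C suc k)) (ℕ.+-comm n 1) ⟩
  + (suc n C suc k)                 ≡⟨ cong +_ (nCk+nC[k+1]≡[n+1]C[k+1] n k) ⟨
  + (n C k ℕ.+ n C suc k)             ≡⟨ pos-+ (n C k) (n C suc k) ⟩
  + (n C k) + + (n C suc k)           ≡⟨ +-comm (+ (n C k)) (+ (n C suc k)) ⟩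
  + (n C suc k) + + (n C k)           ∎
  where open ≡-Reasoning
binomial-pascal -[1+ zero ] (+ suc k) = sym (begin
  -1ℤ * s * + (suc k C suc k) + s * + (k C k)
    ≡⟨ cong₂ (λ x y → -1ℤ * s * + x + s * + y) (nCn≡1 (suc k)) (nCn≡1 k) ⟩
  -1ℤ * s * 1ℤ + s * 1ℤ
    ≡⟨ cancel s ⟩
  0ℤ
    ∎)
  where
  open ≡-Reasoning
  s = -1ℤ ^ℤ k
  cancel : ∀ s → -1ℤ * s * 1ℤ + s * 1ℤ ≡ 0ℤ
  cancel = solve-∀
binomial-pascal -[1+ suc m ] (+ suc k)
  rewrite ℕ.+-suc m k
        | sym (nCk+nC[k+1]≡[n+1]C[k+1] (suc (m ℕ.+ k)) k)
        | pos-+ (suc (m ℕ.+ k) C k) (suc (m ℕ.+ k) C suc k) =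
  regroup (-1ℤ ^ℤ k) (+ (suc (m ℕ.+ k) C k)) (+ (suc (m ℕ.+ k) C suc k))
  where
  regroup : ∀ s x y → -1ℤ * s * y ≡ -1ℤ * s * (x + y) + s * x
  regroup = solve-∀

-- A weight w stands for the ℤ-linear functional on Laurent polynomials sending X₁ᵃX₂ᵇ to w a b.
Weight : Set
Weight = ℤ → ℤ → ℤ

weigh : Weight → LPoly → ℤ
weigh w []                = 0ℤ
weigh w ((c , a , b) ∷ f) = c * w a b + weigh w f

coeffᵂ : ℤ → ℤ → Weight
coeffᵂ a b s r = δ s a * δ r b

coeff≡weigh-coeffᵂ : ∀ f a b → coeff f a b ≡ weigh (coeffᵂ a b) f
coeff≡weigh-coeffᵂ []                  a b = refl
coeff≡weigh-coeffᵂ ((c , e₁ , e₂) ∷ f) a b with e₁ ≟ a | e₂ ≟ b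
... | yes _ | yes _ = cong₂ _+_ (sym (*-identityʳ c)) (coeff≡weigh-coeffᵂ f a b)
... | yes _ | no _  = trans (coeff≡weigh-coeffᵂ f a b) (sym (trans (cong (_+ _) (*-zeroʳ c)) (+-identityˡ _)))
... | no _  | _     = trans (coeff≡weigh-coeffᵂ f a b) (sym (trans (cong (_+ _) (*-zeroʳ c)) (+-identityˡ _)))

weigh-⊕ : ∀ w f g → weigh w (f ⊕ g) ≡ weigh w f + weigh w g
weigh-⊕ w []                g = sym (+-identityˡ _)
weigh-⊕ w ((c , a , b) ∷ f) g =
  trans (cong (_+_ (c * w a b)) (weigh-⊕ w f g)) (sym (+-assoc (c * w a b) _ _))

weigh-⊖ : ∀ w f → weigh w (⊖ f) ≡ - weigh w f
weigh-⊖ w []                = refl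
weigh-⊖ w ((c , a , b) ∷ f) =
  trans (cong₂ _+_ (sym (neg-distribˡ-* c (w a b))) (weigh-⊖ w f)) (sym (neg-distrib-+ (c * w a b) _))

weigh-⊝ : ∀ w f g → weigh w (f ⊝ g) ≡ weigh w f - weigh w g
weigh-⊝ w f g = trans (weigh-⊕ w f (⊖ g)) (cong (_+_ (weigh w f)) (weigh-⊖ w g))

coeff-⊝ : ∀ f g a b → coeff (f ⊝ g) a b ≡ coeff f a b - coeff g a b
coeff-⊝ f g a b = begin
  coeff (f ⊝ g) a b
    ≡⟨ coeff≡weigh-coeffᵂ (f ⊝ g) a b ⟩
  weigh (coeffᵂ a b) (f ⊝ g)
    ≡⟨ weigh-⊝ (coeffᵂ a b) f g ⟩
  weigh (coeffᵂ a b) f - weigh (coeffᵂ a b) g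
    ≡⟨ cong₂ _-_ (coeff≡weigh-coeffᵂ f a b) (coeff≡weigh-coeffᵂ g a b) ⟨
  coeff f a b - coeff g a b
    ∎
  where open ≡-Reasoning

weigh-cong : ∀ {v w} → (∀ a b → v a b ≡ w a b) → ∀ f → weigh v f ≡ weigh w f
weigh-cong v≗w []                = refl
weigh-cong v≗w ((c , a , b) ∷ f) = cong₂ _+_ (cong (c *_) (v≗w a b)) (weigh-cong v≗w f)

weigh-0ʷ : ∀ {w} → (∀ a b → w a b ≡ 0ℤ) → ∀ f → weigh w f ≡ 0ℤ
weigh-0ʷ w≗0 []                = refl
weigh-0ʷ w≗0 ((c , a , b) ∷ f) = cong₂ _+_ (trans (cong (c *_) (w≗0 a b)) (*-zeroʳ c)) (weigh-0ʷ w≗0 f)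

weigh-+ʷ : ∀ v w f → weigh (λ a b → v a b + w a b) f ≡ weigh v f + weigh w f
weigh-+ʷ v w []                = refl
weigh-+ʷ v w ((c , a , b) ∷ f) =
  trans (cong (_+_ (c * (v a b + w a b))) (weigh-+ʷ v w f)) (regroup c (v a b) (w a b) _ _)
  where
  regroup : ∀ c x y X Y → c * (x + y) + (X + Y) ≡ (c * x + X) + (c * y + Y)
  regroup = solve-∀

weigh-negʷ : ∀ w f → weigh (λ a b → - w a b) f ≡ - weigh w f
weigh-negʷ w []                = refl
weigh-negʷ w ((c , a , b) ∷ f) =
  trans (cong₂ _+_ (sym (neg-distribʳ-* c (w a b))) (weigh-negʷ w f)) (sym (neg-distrib-+ (c * w a b) _))

weigh-−ʷ : ∀ v w f → weigh (λ a b → v a b - w a b) f ≡ weigh v f - weigh w f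
weigh-−ʷ v w f = trans (weigh-+ʷ v (λ a b → - w a b) f) (cong (_+_ (weigh v f)) (weigh-negʷ w f))

scale-shift : ℤ → ℤ → ℤ → Term → Term
scale-shift c a b (d , s , r) = (c * d , a + s , b + r)

weigh-map-scale-shift : ∀ w c a b g →
  weigh w (map (scale-shift c a b) g) ≡ c * weigh (λ s r → w (a + s) (b + r)) g
weigh-map-scale-shift w c a b []                = sym (*-zeroʳ c)
weigh-map-scale-shift w c a b ((d , s , r) ∷ g) =
  trans (cong (_+_ (c * d * w (a + s) (b + r))) (weigh-map-scale-shift w c a b g))
        (distrib c d (w (a + s) (b + r)) _)
  where
  distrib : ∀ c d x y → c * d * x + c * y ≡ c * (d * x + y)
  distrib = solve-∀

weigh-⊗ : ∀ w f g → weigh w (f ⊗ g) ≡ weigh (λ a b → weigh (λ s r → w (a + s) (b + r)) g) f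
weigh-⊗ w []                g = refl
weigh-⊗ w ((c , a , b) ∷ f) g =
  trans (weigh-⊕ w (map (scale-shift c a b) g) (f ⊗ g))
        (cong₂ _+_ (weigh-map-scale-shift w c a b g) (weigh-⊗ w f g))

X₁+1 : LPoly
X₁+1 = X₁^ 1ℤ ⊕ one

-- Pᵀ w is the weight f ↦ weigh w (f · P), the transpose of multiplication by P.
X₂ᵀ : Weight → Weight
X₂ᵀ w a b = w a (b + 1ℤ)

[X₁+1]ᵀ : Weight → Weight
[X₁+1]ᵀ w a b = w (a + 1ℤ) b + w a b

genᵀ : Weight → Weight
genᵀ w a b = X₂ᵀ w a b - [X₁+1]ᵀ w a b

weigh-⊗-X₂ : ∀ w f → weigh w (f ⊗ X₂^ 1ℤ) ≡ weigh (X₂ᵀ w) f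
weigh-⊗-X₂ w f = trans (weigh-⊗ w f (X₂^ 1ℤ)) (weigh-cong pointwise f)
  where
  pointwise : ∀ a b → 1ℤ * w (a + 0ℤ) (b + 1ℤ) + 0ℤ ≡ X₂ᵀ w a b
  pointwise a b rewrite +-identityʳ a = trans (+-identityʳ _) (*-identityˡ _)

weigh-⊗-X₁+1 : ∀ w f → weigh w (f ⊗ X₁+1) ≡ weigh ([X₁+1]ᵀ w) f
weigh-⊗-X₁+1 w f = trans (weigh-⊗ w f X₁+1) (weigh-cong pointwise f)
  where
  normalise : ∀ x y → 1ℤ * x + (1ℤ * y + 0ℤ) ≡ x + y
  normalise = solve-∀
  pointwise : ∀ a b → 1ℤ * w (a + 1ℤ) (b + 0ℤ) + (1ℤ * w (a + 0ℤ) (b + 0ℤ) + 0ℤ) ≡ [X₁+1]ᵀ w a b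
  pointwise a b rewrite +-identityʳ a | +-identityʳ b = normalise (w (a + 1ℤ) b) (w a b)

weigh-⊗-gen : ∀ w f → weigh w (f ⊗ gen) ≡ weigh (genᵀ w) f
weigh-⊗-gen w f = trans (weigh-⊗ w f gen) (weigh-cong pointwise f)
  where
  normalise : ∀ x y z → 1ℤ * x + (-1ℤ * y + (-1ℤ * z + 0ℤ)) ≡ x - (y + z)
  normalise = solve-∀
  pointwise : ∀ a b →
    1ℤ * w (a + 0ℤ) (b + 1ℤ) + (-1ℤ * w (a + 1ℤ) (b + 0ℤ) + (-1ℤ * w (a + 0ℤ) (b + 0ℤ) + 0ℤ)) ≡ genᵀ w a b
  pointwise a b rewrite +-identityʳ a | +-identityʳ b = normalise (w a (b + 1ℤ)) (w (a + 1ℤ) b) (w a b)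

remove : ℤ → ℤ → LPoly → LPoly
remove a b []                  = []
remove a b ((c , e₁ , e₂) ∷ f) with e₁ ≟ a | e₂ ≟ b
... | yes _ | yes _ = remove a b f
... | _     | _     = (c , e₁ , e₂) ∷ remove a b f

weigh-remove : ∀ w a b f → weigh w f ≡ coeff f a b * w a b + weigh w (remove a b f)
weigh-remove w a b [] = refl
weigh-remove w a b ((c , e₁ , e₂) ∷ f) with e₁ ≟ a | e₂ ≟ b
... | yes refl | yes refl =
  trans (cong (_+_ (c * w a b)) (weigh-remove w a b f)) (collect c (coeff f a b) (w a b) (weigh w (remove a b f)))
  where
  collect : ∀ c c' x y → c * x + (c' * x + y) ≡ (c + c') * x + y
  collect = solve-∀
... | yes _ | no _ =
  trans (cong (_+_ (c * w e₁ e₂)) (weigh-remove w a b f))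
        (x∙yz≈y∙xz +-commutativeSemigroup (c * w e₁ e₂) (coeff f a b * w a b) (weigh w (remove a b f)))
... | no _  | _    =
  trans (cong (_+_ (c * w e₁ e₂)) (weigh-remove w a b f))
        (x∙yz≈y∙xz +-commutativeSemigroup (c * w e₁ e₂) (coeff f a b * w a b) (weigh w (remove a b f)))

length-remove : ∀ a b f → length (remove a b f) ℕ.≤ length f
length-remove a b []                  = ℕ.z≤n
length-remove a b ((c , e₁ , e₂) ∷ f) with e₁ ≟ a | e₂ ≟ b
... | yes _ | yes _ = ℕ.m≤n⇒m≤1+n (length-remove a b f)
... | yes _ | no _  = ℕ.s≤s (length-remove a b f)
... | no _  | _     = ℕ.s≤s (length-remove a b f)

length-remove-∷ : ∀ c a b f → length (remove a b ((c , a , b) ∷ f)) ℕ.≤ length f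
length-remove-∷ c a b f with a ≟ a | b ≟ b
... | yes _  | yes _  = length-remove a b f
... | no a≢a | _      = contradiction refl a≢a
... | yes _  | no b≢b = contradiction refl b≢b

-- weigh-remove at the weight coeffᵂ a' b' reads
-- coeff f a' b' = coeff f a b · δ a a' · δ b b' + coeff (remove a b f) a' b'.
coeff-remove-∣ : ∀ {d} a b f → (∀ a' b' → d ∣ coeff f a' b') → ∀ a' b' → d ∣ coeff (remove a b f) a' b'
coeff-remove-∣ a b f d∣f a' b' = subst (_ ∣_) (sym (coeff≡weigh-coeffᵂ (remove a b f) a' b'))
  (∣m+n∣m⇒∣n
    (subst (_ ∣_) (trans (coeff≡weigh-coeffᵂ f a' b') (weigh-remove (coeffᵂ a' b') a b f)) (d∣f a' b'))
    (∣m⇒∣m*n (coeffᵂ a' b' a b) (d∣f a b)))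

-- The terms of f may repeat an exponent, so only the collected coefficients are known to be
-- divisible: the proof removes one exponent at a time, by induction on the length of f.
weigh-∣ : ∀ {d} w f → (∀ a b → d ∣ coeff f a b) → d ∣ weigh w f
weigh-∣ {d} w f = go (length f) f ℕ.≤-refl
  where
  go : ∀ n f → length f ℕ.≤ n → (∀ a b → d ∣ coeff f a b) → d ∣ weigh w f
  go _       []                   _               _   = divides 0ℤ refl
  go (suc n) f@((c , a , b) ∷ f') (ℕ.s≤s |f'|≤n) d∣f =
    subst (d ∣_) (sym (weigh-remove w a b f))
      (∣m∣n⇒∣m+n (∣m⇒∣m*n (w a b) (d∣f a b))
                 (go n (remove a b f) (ℕ.≤-trans (length-remove-∷ c a b f') |f'|≤n) (coeff-remove-∣ a b f d∣f)))

QuotEq⇒weigh-∣ : ∀ {p f g} → QuotEq p gen f g →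
  ∀ w → (∀ a b → genᵀ w a b ≡ 0ℤ) → + p ∣ weigh w f - weigh w g
QuotEq⇒weigh-∣ {p} {f} {g} (q , f-g≈q*gen) w genᵀw≗0 =
  subst (+ p ∣_) weigh-difference (weigh-∣ w ((f ⊝ g) ⊝ (q ⊗ gen)) p∣coeff)
  where
  open ≡-Reasoning
  p∣coeff : ∀ a b → + p ∣ coeff ((f ⊝ g) ⊝ (q ⊗ gen)) a b
  p∣coeff a b = subst (+ p ∣_) (sym (coeff-⊝ (f ⊝ g) (q ⊗ gen) a b)) (∣ᵤ⇒∣ (f-g≈q*gen a b))
  weigh-difference : weigh w ((f ⊝ g) ⊝ (q ⊗ gen)) ≡ weigh w f - weigh w g
  weigh-difference = begin
    weigh w ((f ⊝ g) ⊝ (q ⊗ gen))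
      ≡⟨ weigh-⊝ w (f ⊝ g) (q ⊗ gen) ⟩
    weigh w (f ⊝ g) - weigh w (q ⊗ gen)
      ≡⟨ cong₂ _-_ (weigh-⊝ w f g) (trans (weigh-⊗-gen w q) (weigh-0ʷ genᵀw≗0 q)) ⟩
    weigh w f - weigh w g - 0ℤ
      ≡⟨ +-identityʳ _ ⟩
    weigh w f - weigh w g
      ∎

[X₁+1]^ : ℕ → LPoly
[X₁+1]^ zero    = one
[X₁+1]^ (suc n) = [X₁+1]^ n ⊗ X₁+1

geometric : ℕ → LPoly
geometric zero    = []
geometric (suc n) = (geometric n ⊗ X₂^ 1ℤ) ⊕ [X₁+1]^ n

X₂^n-[X₁+1]^n≡geometric*gen : ∀ n w → weigh w (X₂^ (+ n) ⊝ [X₁+1]^ n) ≡ weigh w (geometric n ⊗ gen)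
X₂^n-[X₁+1]^n≡geometric*gen zero w = cancel (w 0ℤ 0ℤ)
  where
  cancel : ∀ x → 1ℤ * x + (-1ℤ * x + 0ℤ) ≡ 0ℤ
  cancel = solve-∀
X₂^n-[X₁+1]^n≡geometric*gen (suc n) w = begin
  weigh w (X₂^ (+ suc n) ⊝ ([X₁+1]^ n ⊗ X₁+1))
    ≡⟨ weigh-⊝ w (X₂^ (+ suc n)) ([X₁+1]^ n ⊗ X₁+1) ⟩
  weigh w (X₂^ (+ suc n)) - weigh w ([X₁+1]^ n ⊗ X₁+1)
    ≡⟨ cong₂ _-_ X₂^[1+n] (weigh-⊗-X₁+1 w ([X₁+1]^ n)) ⟩
  weigh (X₂ᵀ w) (X₂^ (+ n)) - weigh ([X₁+1]ᵀ w) Yⁿ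
    ≡⟨ telescope (weigh (X₂ᵀ w) (X₂^ (+ n))) (weigh ([X₁+1]ᵀ w) Yⁿ) (weigh (X₂ᵀ w) Yⁿ) ⟩
  (weigh (X₂ᵀ w) (X₂^ (+ n)) - weigh (X₂ᵀ w) Yⁿ) + (weigh (X₂ᵀ w) Yⁿ - weigh ([X₁+1]ᵀ w) Yⁿ)
    ≡⟨ cong₂ _+_ (weigh-⊝ (X₂ᵀ w) (X₂^ (+ n)) Yⁿ) (weigh-−ʷ (X₂ᵀ w) ([X₁+1]ᵀ w) Yⁿ) ⟨
  weigh (X₂ᵀ w) (X₂^ (+ n) ⊝ Yⁿ) + weigh (genᵀ w) Yⁿ
    ≡⟨ cong (_+ weigh (genᵀ w) Yⁿ) (X₂^n-[X₁+1]^n≡geometric*gen n (X₂ᵀ w)) ⟩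
  weigh (X₂ᵀ w) (geometric n ⊗ gen) + weigh (genᵀ w) Yⁿ
    ≡⟨ cong (_+ weigh (genᵀ w) Yⁿ) (weigh-⊗-gen (X₂ᵀ w) (geometric n)) ⟩
  weigh (genᵀ (X₂ᵀ w)) (geometric n) + weigh (genᵀ w) Yⁿ
    ≡⟨ cong (_+ weigh (genᵀ w) Yⁿ) (weigh-⊗-X₂ (genᵀ w) (geometric n)) ⟨
  weigh (genᵀ w) (geometric n ⊗ X₂^ 1ℤ) + weigh (genᵀ w) Yⁿ
    ≡⟨ weigh-⊕ (genᵀ w) (geometric n ⊗ X₂^ 1ℤ) Yⁿ ⟨
  weigh (genᵀ w) (geometric (suc n))
    ≡⟨ weigh-⊗-gen w (geometric (suc n)) ⟨
  weigh w (geometric (suc n) ⊗ gen)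
    ∎
  where
  open ≡-Reasoning
  Yⁿ = [X₁+1]^ n
  X₂^[1+n] : weigh w (X₂^ (+ suc n)) ≡ weigh (X₂ᵀ w) (X₂^ (+ n))
  X₂^[1+n] = cong (λ k → 1ℤ * w 0ℤ (+ k) + 0ℤ) (ℕ.+-comm 1 n)
  telescope : ∀ x y z → x - y ≡ (x - z) + (z - y)
  telescope = solve-∀

weigh-coeffᵂ-[X₁+1]^n : ∀ n a b → weigh (coeffᵂ a b) ([X₁+1]^ n) ≡ binomial (+ n) a * δ 0ℤ b
weigh-coeffᵂ-[X₁+1]^n zero a b = trans (normalise (δ 0ℤ a) (δ 0ℤ b)) (cong (_* δ 0ℤ b) (sym (binomial[0,k]≡δ a)))
  where
  normalise : ∀ x y → 1ℤ * (x * y) + 0ℤ ≡ x * y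
  normalise = solve-∀
weigh-coeffᵂ-[X₁+1]^n (suc n) a b = begin
  weigh (coeffᵂ a b) ([X₁+1]^ n ⊗ X₁+1)
    ≡⟨ weigh-⊗-X₁+1 (coeffᵂ a b) ([X₁+1]^ n) ⟩
  weigh ([X₁+1]ᵀ (coeffᵂ a b)) ([X₁+1]^ n)
    ≡⟨ weigh-cong shift-a ([X₁+1]^ n) ⟩
  weigh (λ s r → coeffᵂ (a - 1ℤ) b s r + coeffᵂ a b s r) ([X₁+1]^ n)
    ≡⟨ weigh-+ʷ (coeffᵂ (a - 1ℤ) b) (coeffᵂ a b) ([X₁+1]^ n) ⟩
  weigh (coeffᵂ (a - 1ℤ) b) ([X₁+1]^ n) + weigh (coeffᵂ a b) ([X₁+1]^ n)
    ≡⟨ cong₂ _+_ (weigh-coeffᵂ-[X₁+1]^n n (a - 1ℤ) b) (weigh-coeffᵂ-[X₁+1]^n n a b) ⟩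
  binomial (+ n) (a - 1ℤ) * δ 0ℤ b + binomial (+ n) a * δ 0ℤ b
    ≡⟨ collect (binomial (+ n) (a - 1ℤ)) (binomial (+ n) a) (δ 0ℤ b) ⟩
  (binomial (+ n) a + binomial (+ n) (a - 1ℤ)) * δ 0ℤ b
    ≡⟨ cong (_* δ 0ℤ b) (binomial-pascal (+ n) a) ⟨
  binomial (+ n + 1ℤ) a * δ 0ℤ b
    ≡⟨ cong (λ m → binomial (+ m) a * δ 0ℤ b) (ℕ.+-comm n 1) ⟩
  binomial (+ suc n) a * δ 0ℤ b
    ∎
  where
  open ≡-Reasoning
  shift-a : ∀ s r → [X₁+1]ᵀ (coeffᵂ a b) s r ≡ coeffᵂ (a - 1ℤ) b s r + coeffᵂ a b s r
  shift-a s r = cong (λ d → d * δ r b + coeffᵂ a b s r) (δ-shift s 1ℤ a)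
  collect : ∀ x y d → x * d + y * d ≡ (y + x) * d
  collect = solve-∀

frobeniusDefect : ℤ → ℤ → ℤ
frobeniusDefect z r = binomial z r - δ z r - δ 0ℤ r

frobeniusDefect-interior : ∀ {n j} → 0 ℕ.< j → j ℕ.< n → frobeniusDefect (+ n) (+ j) ≡ + (n C j)
frobeniusDefect-interior {n} {suc j} 0<j j<n
  rewrite δ-≢ {+ n} {+ suc j} (λ n≡j → ℕ.<⇒≢ j<n (sym (+-injective n≡j)))
        | δ-≢ {0ℤ} {+ suc j} λ () = trans (+-identityʳ _) (+-identityʳ _)

≡0⇒∣ : ∀ {d x} → x ≡ 0ℤ → d ∣ x
≡0⇒∣ x≡0 = subst (_ ∣_) (sym x≡0) (divides 0ℤ refl)

∣interior-binomials⇒∣frobeniusDefect : ∀ {d} N → .{{ℕ.NonZero N}} →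
  (∀ k → 0 ℕ.< k → k ℕ.< N → d ℕ.∣ N C k) → ∀ r → + d ∣ frobeniusDefect (+ N) r
∣interior-binomials⇒∣frobeniusDefect N d∣NCk -[1+ r ] = ≡0⇒∣ below
  where
  below : frobeniusDefect (+ N) -[1+ r ] ≡ 0ℤ
  below rewrite δ-≢ {+ N} { -[1+ r ]} (λ ()) | δ-≢ {0ℤ} { -[1+ r ]} (λ ()) = refl
∣interior-binomials⇒∣frobeniusDefect N d∣NCk (+ zero) = ≡0⇒∣ bottom
  where
  bottom : frobeniusDefect (+ N) 0ℤ ≡ 0ℤ
  bottom rewrite δ-≢ {+ N} {0ℤ} (λ N≡0 → ℕ.≢-nonZero⁻¹ N (+-injective N≡0)) | δ-refl 0ℤ = refl
∣interior-binomials⇒∣frobeniusDefect N d∣NCk (+ suc r) with ℕ.<-cmp (suc r) N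
... | tri< 1+r<N _ _ =
  subst (_ ∣_) (sym (frobeniusDefect-interior ℕ.z<s 1+r<N)) (∣ᵤ⇒∣ (d∣NCk (suc r) ℕ.z<s 1+r<N))
... | tri≈ _ refl _ = ≡0⇒∣ top
  where
  top : frobeniusDefect (+ suc r) (+ suc r) ≡ 0ℤ
  top rewrite nCn≡1 (suc r) | δ-refl (+ suc r) | δ-≢ {0ℤ} {+ suc r} (λ ()) = refl
... | tri> _ _ N<1+r = ≡0⇒∣ above
  where
  above : frobeniusDefect (+ N) (+ suc r) ≡ 0ℤ
  above rewrite k>n⇒nCk≡0 N<1+r | δ-≢ {+ N} {+ suc r} (λ N≡1+r → ℕ.<⇒≢ N<1+r (+-injective N≡1+r))
              | δ-≢ {0ℤ} {+ suc r} (λ ()) = refl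

p∣frobeniusDefect[p^n] : ∀ {p} → Prime p → ∀ n r → + p ∣ frobeniusDefect (+ (p ^ n)) r
p∣frobeniusDefect[p^n] {p} p-prime n =
  ∣interior-binomials⇒∣frobeniusDefect (p ^ n) {{ℕ.m^n≢0 p n {{prime⇒nonZero p-prime}}}}
    (λ k → p^k∣n⇒p∣nCj p-prime n ℕ.∣-refl)

p∣frobeniusDefect⇒p-power : ∀ {p} → Prime p →
  ∀ z → (∀ r → + p ∣ frobeniusDefect z r) → ∃[ n ] z ≡ + (p ^ n)
p∣frobeniusDefect⇒p-power p-prime -[1+ m ] p∣defect =
  contradiction (∣⇒∣ᵤ (subst (_ ∣_) diagonal (p∣defect -[1+ m ]))) (p∤1 p-prime)
  where
  diagonal : frobeniusDefect -[1+ m ] -[1+ m ] ≡ -1ℤ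
  diagonal rewrite δ-refl -[1+ m ] | δ-≢ {0ℤ} { -[1+ m ]} (λ ()) = refl
p∣frobeniusDefect⇒p-power {p} p-prime (+ zero) p∣defect =
  contradiction (∣⇒∣ᵤ (subst (+ p ∣_) diagonal (p∣defect 0ℤ))) (p∤1 p-prime)
  where
  diagonal : frobeniusDefect 0ℤ 0ℤ ≡ -1ℤ
  diagonal rewrite δ-refl 0ℤ = refl
p∣frobeniusDefect⇒p-power p-prime (+ suc m) p∣defect with p-power⊎p∤binomial p-prime (suc m)
... | inj₁ (k , 1+m≡p^k) = k , cong +_ 1+m≡p^k
... | inj₂ (j , 0<j , j<1+m , p∤C) =
  contradiction (∣⇒∣ᵤ (subst (_ ∣_) (frobeniusDefect-interior 0<j j<1+m) (p∣defect (+ j)))) p∤C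

-- binomialᵂ r reads off the coefficient of Xʳ after substituting X₁ ↦ X, X₂ ↦ 1 + X.
binomialᵂ : ℤ → Weight
binomialᵂ r a b = binomial b (r - a)

genᵀ-binomialᵂ≡0 : ∀ r a b → genᵀ (binomialᵂ r) a b ≡ 0ℤ
genᵀ-binomialᵂ≡0 r a b =
  trans (cong₂ (λ x y → x - (binomial b y + binomial b (r - a))) (binomial-pascal b (r - a)) (r-[a+1] r a))
        (cancel (binomial b (r - a)) (binomial b (r - a - 1ℤ)))
  where
  r-[a+1] : ∀ r a → r - (a + 1ℤ) ≡ r - a - 1ℤ
  r-[a+1] = solve-∀
  cancel : ∀ x y → x + y - (y + x) ≡ 0ℤ
  cancel = solve-∀

weigh-binomialᵂ≡frobeniusDefect : ∀ z r →
  weigh (binomialᵂ r) (X₂^ z ⊝ X₁^ z) - weigh (binomialᵂ r) one ≡ frobeniusDefect z r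
weigh-binomialᵂ≡frobeniusDefect z r
  rewrite +-identityʳ r | binomial[0,k]≡δ r | binomial[0,k]≡δ (r - z) | sym (δ-shift 0ℤ z r) | +-identityˡ z =
  normalise (binomial z r) (δ z r) (δ 0ℤ r)
  where
  normalise : ∀ x y u → 1ℤ * x + (-1ℤ * y + 0ℤ) - (1ℤ * u + 0ℤ) ≡ x - y - u
  normalise = solve-∀

QuotEq⇒p∣frobeniusDefect : ∀ {p z} → QuotEq p gen (X₂^ z ⊝ X₁^ z) one → ∀ r → + p ∣ frobeniusDefect z r
QuotEq⇒p∣frobeniusDefect {z = z} quotEq r =
  subst (_ ∣_) (weigh-binomialᵂ≡frobeniusDefect z r)
    (QuotEq⇒weigh-∣ {f = X₂^ z ⊝ X₁^ z} {g = one} quotEq (binomialᵂ r) (genᵀ-binomialᵂ≡0 r))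

p∣frobeniusDefect⇒QuotEq : ∀ {p} n → (∀ r → + p ∣ frobeniusDefect (+ n) r) →
  QuotEq p gen (X₂^ (+ n) ⊝ X₁^ (+ n)) one
p∣frobeniusDefect⇒QuotEq {p} n p∣defect = geometric n , λ a b →
  ∣⇒∣ᵤ (subst (+ p ∣_) (sym (coefficient a b)) (∣m⇒∣m*n (δ 0ℤ b) (p∣defect a)))
  where
  open ≡-Reasoning
  coefficient : ∀ a b → coeff ((X₂^ (+ n) ⊝ X₁^ (+ n)) ⊝ one) a b - coeff (geometric n ⊗ gen) a b
                      ≡ frobeniusDefect (+ n) a * δ 0ℤ b
  coefficient a b = begin
    coeff F a b - coeff (geometric n ⊗ gen) a b
      ≡⟨ cong₂ _-_ (coeff≡weigh-coeffᵂ F a b) (coeff≡weigh-coeffᵂ (geometric n ⊗ gen) a b) ⟩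
    weigh W F - weigh W (geometric n ⊗ gen)
      ≡⟨ cong₂ _-_
           (trans (weigh-⊝ W (X₂^ (+ n) ⊝ X₁^ (+ n)) one) (cong (_- weigh W one) (weigh-⊝ W (X₂^ (+ n)) (X₁^ (+ n)))))
           (trans (sym (X₂^n-[X₁+1]^n≡geometric*gen n W)) (weigh-⊝ W (X₂^ (+ n)) ([X₁+1]^ n))) ⟩
    weigh W (X₂^ (+ n)) - weigh W (X₁^ (+ n)) - weigh W one - (weigh W (X₂^ (+ n)) - weigh W ([X₁+1]^ n))
      ≡⟨ cancel (weigh W (X₂^ (+ n))) (weigh W (X₁^ (+ n))) (weigh W one) (weigh W ([X₁+1]^ n)) ⟩
    weigh W ([X₁+1]^ n) - weigh W (X₁^ (+ n)) - weigh W one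
      ≡⟨ cong (λ x → x - weigh W (X₁^ (+ n)) - weigh W one) (weigh-coeffᵂ-[X₁+1]^n n a b) ⟩
    binomial (+ n) a * δ 0ℤ b - (1ℤ * (δ (+ n) a * δ 0ℤ b) + 0ℤ) - (1ℤ * (δ 0ℤ a * δ 0ℤ b) + 0ℤ)
      ≡⟨ factor (binomial (+ n) a) (δ (+ n) a) (δ 0ℤ a) (δ 0ℤ b) ⟩
    frobeniusDefect (+ n) a * δ 0ℤ b
      ∎
    where
    F = (X₂^ (+ n) ⊝ X₁^ (+ n)) ⊝ one
    W = coeffᵂ a b
    cancel : ∀ x y u v → x - y - u - (x - v) ≡ v - y - u
    cancel = solve-∀
    factor : ∀ c x y d → c * d - (1ℤ * (x * d) + 0ℤ) - (1ℤ * (y * d) + 0ℤ) ≡ (c - x - y) * d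
    factor = solve-∀

lemma4p3 : (p : ℕ) → Prime p → (z : ℤ) →
    (∃[ n ] z ≡ + (p ^ n)) ⇔ QuotEq p gen (X₂^ z ⊝ X₁^ z) one
lemma4p3 p p-prime z = mk⇔
  (λ { (n , refl) → p∣frobeniusDefect⇒QuotEq (p ^ n) (p∣frobeniusDefect[p^n] p-prime n) })
  (λ quotEq → p∣frobeniusDefect⇒p-power p-prime z (QuotEq⇒p∣frobeniusDefect quotEq))
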